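{- Let $R$ be a commutative $\mathbb{Q}$-algebra and $\{f(m):\mathfrak{H}^1_\ast\to R\}_{m>0}$ a family of $\mathbb{Q}$-algebra homomorphisms, $w\mapsto f_w(m)$. For $M>0$ define the $\mathbb{Q}$-linear map $coF(M):\mathfrak{H}^1\to R$ by $coF(M)(z_1^r)=(-1)^r\sum_{M>m_1\ge\cdots\ge m_r>0}\mu^{m_1,\dots,m_r}f_{z_1}(m_1)\cdots f_{z_1}(m_r)$ for $r\ge0$ (in particular $coF(M)(1)=1$) and $coF(M)(z_{k_1}\cdots z_{k_r})=0$ if some $k_i\ne1$. Then for every $M>0$, $coF(M):\mathfrak{H}^1_\ast\to R$ is an algebra homomorphism.
   Context: $\mathfrak{H}^1=\mathbb{Q}\langle z_k\mid k\ge1\rangle$ and $\mathfrak{H}^1_\ast$ is $\mathfrak{H}^1$ with the harmonic product: bilinear, $1\ast w=w\ast1=w$, $z_ku\ast z_lv=z_k(u\ast z_lv)+z_l(z_ku\ast v)+z_{k+l}(u\ast v)$. For a non-increasing sequence $(m_1,\dots,m_r)$ consisting of $s$ distinct values with multiplicities $r_1,\dots,r_s$, $\mu^{m_1,\dots,m_r}=1/(r_1!\cdots r_s!)$. -}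

module Defs where

open import Level using (Level)
open import Data.Nat as ℕ using (ℕ; zero; suc; _!)
open import Data.Nat.Properties using (_!≢0)
open import Data.Integer using (+_)
open import Data.Rational as ℚ using (ℚ)
import Data.Rational.Properties as ℚP
open import Data.List using (List; []; _∷_; [_]; map; _++_; concatMap; length; filter; deduplicate; upTo; foldr)
open import Data.Product using (_×_; _,_)
open import Data.Bool using (Bool; true; false; if_then_else_)
open import Algebra.Bundles using (CommutativeRing)
open import Algebra.Morphism.Structures using (IsRingHomomorphism)

-- ENCODING: the letter z_k is represented by the natural number k - 1,
-- i.e.  letter n  stands for  z_(n+1).  So z_1 is 0, and z_(k+l)
-- (with k = a+1, l = b+1) is  suc (a + b).

Letter : Set
Letter = ℕ

Word : Set
Word = List Letter

_⊕_ : Letter → Letter → Letter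
a ⊕ b = suc (a ℕ.+ b)

-- Harmonic (stuffle) product of two words, as a formal sum of words
-- with multiplicity (all coefficients are 1):
--   1 ∗ w = w ∗ 1 = w,
--   z_k u ∗ z_l v = z_k (u ∗ z_l v) + z_l (z_k u ∗ v) + z_{k+l} (u ∗ v).
_∗w_ : Word → Word → List Word
[] ∗w v = [ v ]
(a ∷ u) ∗w [] = [ a ∷ u ]
(a ∷ u) ∗w (b ∷ v) =
  map (a ∷_) (u ∗w (b ∷ v)) ++ map (b ∷_) ((a ∷ u) ∗w v) ++ map ((a ⊕ b) ∷_) (u ∗w v)

-- 𝔥¹ = ℚ⟨z_k | k ≥ 1⟩ : elements are formal ℚ-linear combinations of
-- words, represented as lists of (coefficient, word).

H¹ : Set
H¹ = List (ℚ × Word)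

𝟙 : H¹
𝟙 = [ (ℚ.1ℚ , []) ]

_∗_ : H¹ → H¹ → H¹
x ∗ y = concatMap (λ { (p , u) → concatMap (λ { (q , v) → map (λ w → (p ℚ.* q , w)) (u ∗w v) }) y }) x

module _ {c ℓ : Level} (R : CommutativeRing c ℓ) where
  open CommutativeRing R

  -- A commutative ℚ-algebra structure on R: a ring homomorphism ℚ → R.
  IsℚAlgebra : (ℚ → Carrier) → Set ℓ
  IsℚAlgebra ι = IsRingHomomorphism ℚP.+-*-rawRing rawRing ι

  module _ (ι : ℚ → Carrier) where

    -- A ℚ-linear map 𝔥¹ → R is determined by its values on the basis of
    -- words; `lin φ` is the ℚ-linear extension of φ : Word → R.
    lin : (Word → Carrier) → H¹ → Carrier
    lin φ [] = 0#
    lin φ ((q , w) ∷ x) = ι q * φ w + lin φ x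

    IsAlgHom : (Word → Carrier) → Set ℓ
    IsAlgHom φ = (lin φ 𝟙 ≈ 1#) × (∀ x y → lin φ (x ∗ y) ≈ lin φ x * lin φ y)

    prod : List Carrier → Carrier
    prod = foldr _*_ 1#

    sum : List Carrier → Carrier
    sum = foldr _+_ 0#

    sgn : ℕ → Carrier
    sgn zero = 1#
    sgn (suc r) = - sgn r

nonIncSeqs : ℕ → ℕ → List (List ℕ)
nonIncSeqs b zero = [ [] ]
nonIncSeqs b (suc r) = concatMap (λ m → map (m ∷_) (nonIncSeqs m r)) (map suc (upTo b))

count : ℕ → List ℕ → ℕ
count v xs = length (filter (ℕ._≟ v) xs)

μ : List ℕ → ℚ
μ ms = foldr (λ v acc → ((+ 1) ℚ./ (count v ms !)) {{count v ms !≢0}} ℚ.* acc) ℚ.1ℚ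
             (deduplicate ℕ._≟_ ms)

allZ₁ : Word → Bool
allZ₁ [] = true
allZ₁ (zero ∷ w) = allZ₁ w
allZ₁ (suc _ ∷ w) = false

module _ {c ℓ : Level} (R : CommutativeRing c ℓ) (ι : ℚ → CommutativeRing.Carrier R) where
  open CommutativeRing R

  -- coF(M) on words:
  --   coF(M)(z_1^r) = (-1)^r Σ_{M > m_1 ≥ ⋯ ≥ m_r > 0} μ^{m_1…m_r} f_{z_1}(m_1)⋯f_{z_1}(m_r),
  --   coF(M)(w) = 0 if w contains a letter z_k with k ≠ 1.
  -- Here f m w = f_w(m); the letter z_1 is encoded as 0.
  coF : (ℕ → Word → Carrier) → ℕ → Word → Carrier
  coF f M w =
    if allZ₁ w
    then sgn R ι (length w) *
         sum R ι (map (λ ms → ι (μ ms) * prod R ι (map (λ m → f m [ 0 ]) ms))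
                      (nonIncSeqs (M ℕ.∸ 1) (length w)))
    else 0#

module Submission where

-- Only the values x m = f_{z₁}(m) enter coF(M). Collecting equal entries of a non-increasing
-- sequence, Σ μ^{m₁…m_r} x m₁ ⋯ x m_r is the multinomial expansion of p^r / r! with
-- p = x 1 + ⋯ + x (M - 1), so coF(M)(z₁^r) = (-p)^r / r!. A sequence γ r = y^r / r! is a divided
-- power sequence, γ a · γ b = C(a+b, a) · γ (a+b), and that is exactly what multiplicativity for ∗
-- asks of a functional supported on powers of z₁: z₁^a ∗ z₁^b is C(a+b, a) z₁^(a+b) plus words
-- containing a letter z_k with k ≥ 2.

open import Defs
open import Level using (Level)
open import Data.Nat using (ℕ; _<_)
open import Data.Rational using (ℚ)
open import Algebra.Bundles using (CommutativeRing)

open import Algebra.Morphism.Structures using (IsRingHomomorphism)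
open import Data.Bool using (true; false; if_then_else_)
open import Data.Fin using (Fin; toℕ)
import Data.Fin.Properties as Fin
open import Data.Integer as ℤ using (+_)
import Data.Integer.Properties as ℤ
open import Data.List using (List; []; _∷_; [_]; _++_; map; replicate; filter; deduplicate; length; foldr; concatMap; upTo)
import Data.List.Properties as List
open import Data.List.Relation.Unary.All as All using (All; []; _∷_)
import Data.List.Relation.Unary.All.Properties as All
open import Data.Nat as ℕ using (zero; suc; _∸_; _≤_; _≟_; _!)
import Data.Nat.Properties as ℕ
open import Data.Nat.Combinatorics using (_C_; nCn≡1; nCk+nC[k+1]≡[n+1]C[k+1])
open import Data.Nat.Combinatorics.Specification using (nCk≡n!/k![n-k]!; [n∸k]!k!∣n!)
open import Data.Nat.Coprimality as Coprime using (1-coprimeTo)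
open import Data.Nat.DivMod using (m/n*n≡m)
open import Data.Nat.Divisibility using (_∣_)
import Data.Rational as ℚ
open import Data.Rational using (mkℚ)
import Data.Rational.Properties as ℚ
open import Data.Product as Product using (_,_)
open import Function using (_∘_; id)
open import Relation.Binary.PropositionalEquality as ≡ using (_≡_; _≢_; refl)
open import Relation.Nullary using (¬?)

nCk*[k!*[n∸k]!]≡n! : ∀ {n k} → k ≤ n → (n C k) ℕ.* (k ! ℕ.* (n ∸ k) !) ≡ n !
nCk*[k!*[n∸k]!]≡n! {n} {k} k≤n = begin
  (n C k) ℕ.* (k ! ℕ.* (n ∸ k) !)
    ≡⟨ ≡.cong (ℕ._* (k ! ℕ.* (n ∸ k) !)) (nCk≡n!/k![n-k]! k≤n) ⟩
  n ! ℕ./ (k ! ℕ.* (n ∸ k) !) ℕ.* (k ! ℕ.* (n ∸ k) !)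
    ≡⟨ m/n*n≡m k!*[n∸k]!∣n! ⟩
  n ! ∎
  where
  open ≡.≡-Reasoning
  instance
    k!*[n∸k]!≢0 : ℕ.NonZero (k ! ℕ.* (n ∸ k) !)
    k!*[n∸k]!≢0 = k ℕ.!* (n ∸ k) !≢0
  k!*[n∸k]!∣n! : k ! ℕ.* (n ∸ k) ! ∣ n !
  k!*[n∸k]!∣n! = ≡.subst (_∣ n !) (ℕ.*-comm ((n ∸ k) !) (k !)) ([n∸k]!k!∣n! k≤n)

1/_! : ℕ → ℚ
1/ n ! = ((+ 1) ℚ./ (n !)) {{n ℕ.!≢0}}

[1+n]/1≡1+n/1 : ∀ n → (+ suc n) ℚ./ 1 ≡ ℚ.1ℚ ℚ.+ (+ n) ℚ./ 1
[1+n]/1≡1+n/1 n = begin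
  (+ suc n) ℚ./ 1                  ≡⟨ ≡.cong (λ k → (+ 1 ℤ.+ k) ℚ./ 1) (≡.sym (ℤ.*-identityʳ (+ n))) ⟩
  (+ 1 ℤ.+ (+ n) ℤ.* (+ 1)) ℚ./ 1  ≡⟨⟩
  ℚ.1ℚ ℚ.+ mkℚ (+ n) 0 n⊥1         ≡⟨ ≡.cong (ℚ.1ℚ ℚ.+_) (≡.sym (ℚ.normalize-coprime n⊥1)) ⟩
  ℚ.1ℚ ℚ.+ (+ n) ℚ./ 1             ∎
  where
  open ≡.≡-Reasoning
  n⊥1 : Coprime.Coprime n 1
  n⊥1 = Coprime.sym (1-coprimeTo n)

1/n*n≡1 : ∀ n → .{{_ : ℕ.NonZero n}} → ((+ 1) ℚ./ n) ℚ.* ((+ n) ℚ./ 1) ≡ ℚ.1ℚ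
1/n*n≡1 (suc n) =
  ≡.trans (≡.cong₂ ℚ._*_ (ℚ.normalize-coprime (1-coprimeTo (suc n)))
                         (ℚ.normalize-coprime (Coprime.sym (1-coprimeTo (suc n)))))
          (ℚ.*-inverseˡ (mkℚ (+ suc n) 0 (Coprime.sym (1-coprimeTo (suc n)))))

count-replicate-++ : ∀ {c ms} → All (c ≢_) ms → ∀ k → count c (replicate k c ++ ms) ≡ k
count-replicate-++ {c} c∉ms zero    = ≡.cong length (List.filter-none (_≟ c) (All.map (_∘ ≡.sym) c∉ms))
count-replicate-++ {c} c∉ms (suc k) =
  ≡.trans (≡.cong length (List.filter-accept (_≟ c) refl)) (≡.cong suc (count-replicate-++ c∉ms k))

count-replicate-++-≢ : ∀ {c v} ms → c ≢ v → ∀ k → count v (replicate k c ++ ms) ≡ count v ms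
count-replicate-++-≢ ms c≢v zero    = refl
count-replicate-++-≢ {v = v} ms c≢v (suc k) =
  ≡.trans (≡.cong length (List.filter-reject (_≟ v) c≢v)) (count-replicate-++-≢ ms c≢v k)

deduplicate-replicate-++ : ∀ {c ms} → All (c ≢_) ms → ∀ k →
  filter (¬? ∘ (c ≟_)) (deduplicate _≟_ (replicate k c ++ ms)) ≡ deduplicate _≟_ ms
deduplicate-replicate-++ {c} c∉ms zero    = List.filter-all (¬? ∘ (c ≟_)) (All.deduplicate⁺ _≟_ c∉ms)
deduplicate-replicate-++ {c} {ms} c∉ms (suc k) =
  ≡.trans (List.filter-reject (¬? ∘ (c ≟_)) (λ c≢c → c≢c refl))
          (≡.trans (List.filter-idem (¬? ∘ (c ≟_)) (deduplicate _≟_ (replicate k c ++ ms)))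
                   (deduplicate-replicate-++ c∉ms k))

-- μ ms unfolds to inverseMultiplicities ms (deduplicate _≟_ ms).
inverseMultiplicities : List ℕ → List ℕ → ℚ
inverseMultiplicities ms = foldr (λ v q → 1/ count v ms ! ℚ.* q) ℚ.1ℚ

inverseMultiplicities-cong : ∀ ms ns {vs} → All (λ v → count v ms ≡ count v ns) vs →
                             inverseMultiplicities ms vs ≡ inverseMultiplicities ns vs
inverseMultiplicities-cong ms ns []         = refl
inverseMultiplicities-cong ms ns (eq ∷ eqs) =
  ≡.cong₂ ℚ._*_ (≡.cong 1/_! eq) (inverseMultiplicities-cong ms ns eqs)

μ-replicate-++ : ∀ {c ms} → All (c ≢_) ms → ∀ k → μ (replicate k c ++ ms) ≡ 1/ k ! ℚ.* μ ms
μ-replicate-++ {ms = ms} c∉ms zero    = ≡.sym (ℚ.*-identityˡ (μ ms))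
μ-replicate-++ {c} {ms} c∉ms (suc k) = ≡.cong₂ ℚ._*_
  (≡.cong 1/_! (count-replicate-++ c∉ms (suc k)))
  (≡.trans (≡.cong (inverseMultiplicities cms) (deduplicate-replicate-++ c∉ms k))
           (inverseMultiplicities-cong cms ms
             (All.deduplicate⁺ _≟_ (All.map (λ c≢v → count-replicate-++-≢ ms c≢v (suc k)) c∉ms))))
  where cms = replicate (suc k) c ++ ms

nonIncSeqs-suc : ∀ b r →
  nonIncSeqs (suc b) (suc r) ≡ nonIncSeqs b (suc r) ++ map (suc b ∷_) (nonIncSeqs (suc b) r)
nonIncSeqs-suc b r = begin
  concatMap extend (map suc (upTo (suc b)))
    ≡⟨ ≡.cong (concatMap extend ∘ map suc) (≡.sym (List.applyUpTo-∷ʳ id b)) ⟩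
  concatMap extend (map suc (upTo b ++ [ b ]))
    ≡⟨ ≡.cong (concatMap extend) (List.map-++ suc (upTo b) [ b ]) ⟩
  concatMap extend (map suc (upTo b) ++ [ suc b ])
    ≡⟨ List.concatMap-++ extend (map suc (upTo b)) [ suc b ] ⟩
  nonIncSeqs b (suc r) ++ extend (suc b) ++ []
    ≡⟨ ≡.cong (nonIncSeqs b (suc r) ++_) (List.++-identityʳ (extend (suc b))) ⟩
  nonIncSeqs b (suc r) ++ extend (suc b) ∎
  where
  open ≡.≡-Reasoning
  extend : ℕ → List (List ℕ)
  extend m = map (m ∷_) (nonIncSeqs m r)

nonIncSeqs-bounded : ∀ b r → All (All (_≤ b)) (nonIncSeqs b r)
nonIncSeqs-bounded b       zero    = [] ∷ []
nonIncSeqs-bounded zero    (suc r) = []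
nonIncSeqs-bounded (suc b) (suc r) rewrite nonIncSeqs-suc b r =
  All.++⁺ (All.map (All.map ℕ.m≤n⇒m≤1+n) (nonIncSeqs-bounded b (suc r)))
          (All.map⁺ (All.map (ℕ.≤-refl ∷_) (nonIncSeqs-bounded (suc b) r)))

replicate-++-∷ : ∀ {A : Set} k (a : A) xs → replicate k a ++ a ∷ xs ≡ replicate (suc k) a ++ xs
replicate-++-∷ zero    a xs = refl
replicate-++-∷ (suc k) a xs = ≡.cong (a ∷_) (replicate-++-∷ k a xs)

NotZ₁Power : Word → Set
NotZ₁Power w = allZ₁ w ≡ false

NotZ₁Power-∷ : ∀ a {w} → NotZ₁Power w → NotZ₁Power (a ∷ w)
NotZ₁Power-∷ zero    w∉ = w∉
NotZ₁Power-∷ (suc a) _  = refl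

allZ₁⇒replicate : ∀ w → allZ₁ w ≡ true → w ≡ replicate (length w) 0
allZ₁⇒replicate []           _  = refl
allZ₁⇒replicate (zero ∷ w)   z₁ = ≡.cong (0 ∷_) (allZ₁⇒replicate w z₁)
allZ₁⇒replicate (suc _ ∷ w) ()

-- Stuffling never removes a letter z_k with k ≥ 2: it survives either as itself or inside z_{k+l}.
∗w-NotZ₁Powerˡ : ∀ u v → NotZ₁Power u → All NotZ₁Power (u ∗w v)
∗w-NotZ₁Powerˡ (a ∷ u) []      u∉ = u∉ ∷ []
∗w-NotZ₁Powerˡ (a ∷ u) (b ∷ v) u∉ =
  All.++⁺ (All.map⁺ (first a u∉))
          (All.++⁺ (All.map⁺ (All.map (NotZ₁Power-∷ b) (∗w-NotZ₁Powerˡ (a ∷ u) v u∉)))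
                   (All.map⁺ (All.tabulate λ _ → refl)))
  where
  first : ∀ a → NotZ₁Power (a ∷ u) → All (NotZ₁Power ∘ (a ∷_)) (u ∗w (b ∷ v))
  first zero    u∉ = ∗w-NotZ₁Powerˡ u (b ∷ v) u∉
  first (suc a) _  = All.tabulate λ _ → refl

∗w-NotZ₁Powerʳ : ∀ u v → NotZ₁Power v → All NotZ₁Power (u ∗w v)
∗w-NotZ₁Powerʳ []      v       v∉ = v∉ ∷ []
∗w-NotZ₁Powerʳ (a ∷ u) (b ∷ v) v∉ =
  All.++⁺ (All.map⁺ (All.map (NotZ₁Power-∷ a) (∗w-NotZ₁Powerʳ u (b ∷ v) v∉)))
          (All.++⁺ (All.map⁺ (second b v∉))
                   (All.map⁺ (All.tabulate λ _ → refl)))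
  where
  second : ∀ b → NotZ₁Power (b ∷ v) → All (NotZ₁Power ∘ (b ∷_)) ((a ∷ u) ∗w v)
  second zero    v∉ = ∗w-NotZ₁Powerʳ (a ∷ u) v v∉
  second (suc b) _  = All.tabulate λ _ → refl

module _ {c ℓ : Level} (R : CommutativeRing c ℓ) where

  open CommutativeRing R renaming (refl to ≈-refl)
  open import Algebra.Properties.Semiring.Mult semiring using (_×_; ×-comm-*; ×-assoc-*; ×-congʳ; ×-homo-+; ×1-homo-*)
  open import Algebra.Properties.CommutativeSemigroup *-commutativeSemigroup using (interchange; x∙yz≈y∙xz)
  open import Algebra.Properties.Semiring.Exp semiring using (_^_; ^-homo-*)
  open import Algebra.Properties.Ring ring using (-‿distribˡ-*)
  open import Algebra.Properties.Semiring.Sum semiring using (sum⁺-syntax; *-distribˡ-sum; sum-cong-≋)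
  import Algebra.Properties.CommutativeSemiring.Binomial commutativeSemiring as Binomial
  open import Relation.Binary.Reasoning.Setoid setoid

  ∑-over : {A : Set} → List A → (A → Carrier) → Carrier
  ∑-over xs f = foldr _+_ 0# (map f xs)

  syntax ∑-over xs (λ x → e) = ∑[ x ∈ xs ] e

  module _ {A : Set} where

    ∑-++ : ∀ (f : A → Carrier) xs ys → ∑[ x ∈ xs ++ ys ] f x ≈ ∑[ x ∈ xs ] f x + ∑[ x ∈ ys ] f x
    ∑-++ f []       ys = sym (+-identityˡ _)
    ∑-++ f (x ∷ xs) ys = trans (+-congˡ (∑-++ f xs ys)) (sym (+-assoc _ _ _))

    ∑-map : ∀ {B : Set} (f : B → Carrier) (g : A → B) xs → ∑[ y ∈ map g xs ] f y ≡ ∑[ x ∈ xs ] f (g x)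
    ∑-map f g xs = ≡.cong (foldr _+_ 0#) (≡.sym (List.map-∘ xs))

    ∑-cong : ∀ {f g : A → Carrier} {xs} → All (λ x → f x ≈ g x) xs → ∑[ x ∈ xs ] f x ≈ ∑[ x ∈ xs ] g x
    ∑-cong []         = ≈-refl
    ∑-cong (eq ∷ eqs) = +-cong eq (∑-cong eqs)

    ∑-zero : ∀ {f : A → Carrier} {xs} → All (λ x → f x ≈ 0#) xs → ∑[ x ∈ xs ] f x ≈ 0#
    ∑-zero []         = ≈-refl
    ∑-zero (eq ∷ eqs) = trans (+-cong eq (∑-zero eqs)) (+-identityˡ 0#)

    *-distribˡ-∑ : ∀ y (f : A → Carrier) xs → y * ∑[ x ∈ xs ] f x ≈ ∑[ x ∈ xs ] (y * f x)
    *-distribˡ-∑ y f []       = zeroʳ y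
    *-distribˡ-∑ y f (x ∷ xs) = trans (distribˡ y _ _) (+-congˡ (*-distribˡ-∑ y f xs))

  record IsDividedPowerSequence (γ : ℕ → Carrier) : Set ℓ where
    field
      γ-zero : γ 0 ≈ 1#
      γ-*    : ∀ m n → γ m * γ n ≈ ((m ℕ.+ n) C m) × γ (m ℕ.+ n)

  IsDividedPowerSequence-cong : ∀ {γ δ} → (∀ n → γ n ≈ δ n) →
                                IsDividedPowerSequence δ → IsDividedPowerSequence γ
  IsDividedPowerSequence-cong {γ} {δ} γ≈δ δ-dp = record
    { γ-zero = trans (γ≈δ 0) (IsDividedPowerSequence.γ-zero δ-dp)
    ; γ-*    = λ m n → begin
        γ m * γ n                              ≈⟨ *-cong (γ≈δ m) (γ≈δ n) ⟩
        δ m * δ n                              ≈⟨ IsDividedPowerSequence.γ-* δ-dp m n ⟩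
        ((m ℕ.+ n) C m) × δ (m ℕ.+ n)          ≈⟨ ×-congʳ ((m ℕ.+ n) C m) (sym (γ≈δ (m ℕ.+ n))) ⟩
        ((m ℕ.+ n) C m) × γ (m ℕ.+ n)          ∎
    }

  onZ₁Powers : (ℕ → Carrier) → Word → Carrier
  onZ₁Powers γ w = if allZ₁ w then γ (length w) else 0#

  onZ₁Powers-replicate : ∀ γ n → onZ₁Powers γ (replicate n 0) ≡ γ n
  onZ₁Powers-replicate γ zero    = refl
  onZ₁Powers-replicate γ (suc n) = onZ₁Powers-replicate (γ ∘ suc) n

  onZ₁Powers-NotZ₁Power : ∀ γ {w} → NotZ₁Power w → onZ₁Powers γ w ≈ 0#
  onZ₁Powers-NotZ₁Power γ w∉ rewrite w∉ = ≈-refl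

  ∑-onZ₁Powers-NotZ₁Power : ∀ γ {ws} → All NotZ₁Power ws → ∑[ w ∈ ws ] onZ₁Powers γ w ≈ 0#
  ∑-onZ₁Powers-NotZ₁Power γ ws∉ = ∑-zero (All.map (λ {w} → onZ₁Powers-NotZ₁Power γ {w}) ws∉)

  ∑-onZ₁Powers-z₁∷ : ∀ γ ws →
    ∑[ w ∈ map (0 ∷_) ws ] onZ₁Powers γ w ≡ ∑[ w ∈ ws ] onZ₁Powers (γ ∘ suc) w
  ∑-onZ₁Powers-z₁∷ γ = ∑-map (onZ₁Powers γ) (0 ∷_)

  ∑-onZ₁Powers-zₖ∷ : ∀ γ a ws → ∑[ w ∈ map (suc a ∷_) ws ] onZ₁Powers γ w ≈ 0#
  ∑-onZ₁Powers-zₖ∷ γ a ws =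
    trans (reflexive (∑-map (onZ₁Powers γ) (suc a ∷_) ws)) (∑-zero {xs = ws} (All.tabulate λ _ → ≈-refl))

  ∑-onZ₁Powers-replicate-∗w : ∀ γ m n →
    ∑[ w ∈ replicate m 0 ∗w replicate n 0 ] onZ₁Powers γ w ≈ ((m ℕ.+ n) C m) × γ (m ℕ.+ n)
  ∑-onZ₁Powers-replicate-∗w γ zero    n = +-congʳ (reflexive (onZ₁Powers-replicate γ n))
  ∑-onZ₁Powers-replicate-∗w γ (suc m) zero
    rewrite ℕ.+-identityʳ m | nCn≡1 (suc m) = +-congʳ (reflexive (onZ₁Powers-replicate γ (suc m)))
  ∑-onZ₁Powers-replicate-∗w γ (suc m) (suc n) = begin
    ∑[ w ∈ map (0 ∷_) (zᵐ ∗w z¹⁺ⁿ) ++ map (0 ∷_) (z¹⁺ᵐ ∗w zⁿ) ++ map (1 ∷_) (zᵐ ∗w zⁿ) ] φ w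
      ≈⟨ trans (∑-++ φ (map (0 ∷_) (zᵐ ∗w z¹⁺ⁿ)) _) (+-congˡ (∑-++ φ (map (0 ∷_) (z¹⁺ᵐ ∗w zⁿ)) _)) ⟩
    ∑[ w ∈ map (0 ∷_) (zᵐ ∗w z¹⁺ⁿ) ] φ w
      + (∑[ w ∈ map (0 ∷_) (z¹⁺ᵐ ∗w zⁿ) ] φ w + ∑[ w ∈ map (1 ∷_) (zᵐ ∗w zⁿ) ] φ w)
      ≈⟨ +-congˡ (trans (+-congˡ (∑-onZ₁Powers-zₖ∷ γ 0 (zᵐ ∗w zⁿ))) (+-identityʳ _)) ⟩
    ∑[ w ∈ map (0 ∷_) (zᵐ ∗w z¹⁺ⁿ) ] φ w + ∑[ w ∈ map (0 ∷_) (z¹⁺ᵐ ∗w zⁿ) ] φ w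
      ≡⟨ ≡.cong₂ _+_ (∑-onZ₁Powers-z₁∷ γ (zᵐ ∗w z¹⁺ⁿ)) (∑-onZ₁Powers-z₁∷ γ (z¹⁺ᵐ ∗w zⁿ)) ⟩
    ∑[ w ∈ zᵐ ∗w z¹⁺ⁿ ] onZ₁Powers γ′ w + ∑[ w ∈ z¹⁺ᵐ ∗w zⁿ ] onZ₁Powers γ′ w
      ≈⟨ +-cong (∑-onZ₁Powers-replicate-∗w γ′ m (suc n)) (∑-onZ₁Powers-replicate-∗w γ′ (suc m) n) ⟩
    (N C m) × γ′ N + ((suc m ℕ.+ n) C suc m) × γ′ (suc m ℕ.+ n)
      ≡⟨ ≡.cong (λ k → (N C m) × γ′ N + (k C suc m) × γ′ k) (≡.sym (ℕ.+-suc m n)) ⟩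
    (N C m) × γ′ N + (N C suc m) × γ′ N
      ≈⟨ sym (×-homo-+ (γ′ N) (N C m) (N C suc m)) ⟩
    (N C m ℕ.+ N C suc m) × γ′ N
      ≡⟨ ≡.cong (_× γ′ N) (nCk+nC[k+1]≡[n+1]C[k+1] N m) ⟩
    (suc N C suc m) × γ (suc N) ∎
    where
    φ = onZ₁Powers γ
    γ′ = γ ∘ suc
    N = m ℕ.+ suc n
    zᵐ = replicate m 0
    zⁿ = replicate n 0
    z¹⁺ᵐ = replicate (suc m) 0
    z¹⁺ⁿ = replicate (suc n) 0

  ∑-onZ₁Powers-∗w : ∀ {γ} → IsDividedPowerSequence γ → ∀ u v →
                    ∑[ w ∈ u ∗w v ] onZ₁Powers γ w ≈ onZ₁Powers γ u * onZ₁Powers γ v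
  ∑-onZ₁Powers-∗w {γ} γ-dp u v with allZ₁ u in u-z₁ | allZ₁ v in v-z₁
  ... | false | _    = trans (∑-onZ₁Powers-NotZ₁Power γ (∗w-NotZ₁Powerˡ u v u-z₁)) (sym (zeroˡ _))
  ... | true  | false = trans (∑-onZ₁Powers-NotZ₁Power γ (∗w-NotZ₁Powerʳ u v v-z₁)) (sym (zeroʳ _))
  ... | true  | true  = begin
    ∑[ w ∈ u ∗w v ] onZ₁Powers γ w
      ≡⟨ ≡.cong₂ (λ u v → ∑[ w ∈ u ∗w v ] onZ₁Powers γ w)
                 (allZ₁⇒replicate u u-z₁) (allZ₁⇒replicate v v-z₁) ⟩
    ∑[ w ∈ replicate (length u) 0 ∗w replicate (length v) 0 ] onZ₁Powers γ w
      ≈⟨ ∑-onZ₁Powers-replicate-∗w γ (length u) (length v) ⟩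
    ((length u ℕ.+ length v) C length u) × γ (length u ℕ.+ length v)
      ≈⟨ sym (IsDividedPowerSequence.γ-* γ-dp (length u) (length v)) ⟩
    γ (length u) * γ (length v) ∎

  module _ (ι : ℚ → Carrier) (ι-hom : IsℚAlgebra R ι) where

    private module ι = IsRingHomomorphism ι-hom

    module _ (φ : Word → Carrier) where

      lin-++ : ∀ x y → lin R ι φ (x ++ y) ≈ lin R ι φ x + lin R ι φ y
      lin-++ []      y = sym (+-identityˡ _)
      lin-++ (_ ∷ x) y = trans (+-congˡ (lin-++ x y)) (sym (+-assoc _ _ _))

      lin-map : ∀ q ws → lin R ι φ (map (q ,_) ws) ≈ ι q * ∑[ w ∈ ws ] φ w
      lin-map q []       = sym (zeroʳ _)
      lin-map q (w ∷ ws) = trans (+-congˡ (lin-map q ws)) (sym (distribˡ _ _ _))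

      lin-concatMap : ∀ {h : ℚ Product.× Word → H¹} k →
                      (∀ q w → lin R ι φ (h (q , w)) ≈ (ι q * φ w) * k) →
                      ∀ x → lin R ι φ (concatMap h x) ≈ lin R ι φ x * k
      lin-concatMap k h-lin []            = sym (zeroˡ k)
      lin-concatMap {h} k h-lin ((q , w) ∷ x) = begin
        lin R ι φ (h (q , w) ++ concatMap h x)            ≈⟨ lin-++ (h (q , w)) (concatMap h x) ⟩
        lin R ι φ (h (q , w)) + lin R ι φ (concatMap h x) ≈⟨ +-cong (h-lin q w) (lin-concatMap k h-lin x) ⟩
        (ι q * φ w) * k + lin R ι φ x * k                 ≈⟨ sym (distribʳ k _ _) ⟩
        (ι q * φ w + lin R ι φ x) * k                     ∎

      lin-∗ : (∀ u v → ∑[ w ∈ u ∗w v ] φ w ≈ φ u * φ v) →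
              ∀ x y → lin R ι φ (x ∗ y) ≈ lin R ι φ x * lin R ι φ y
      lin-∗ φ-∗w x y =
        lin-concatMap (lin R ι φ y) (λ p u → trans (lin-concatMap (ι p * φ u) (term p u) y) (*-comm _ _)) x
        where
        term : ∀ p u q v → lin R ι φ (map (p ℚ.* q ,_) (u ∗w v)) ≈ (ι q * φ v) * (ι p * φ u)
        term p u q v = begin
          lin R ι φ (map (p ℚ.* q ,_) (u ∗w v)) ≈⟨ lin-map (p ℚ.* q) (u ∗w v) ⟩
          ι (p ℚ.* q) * ∑[ w ∈ u ∗w v ] φ w    ≈⟨ *-cong (ι.*-homo p q) (φ-∗w u v) ⟩
          (ι p * ι q) * (φ u * φ v)             ≈⟨ interchange (ι p) (ι q) (φ u) (φ v) ⟩
          (ι p * φ u) * (ι q * φ v)             ≈⟨ *-comm _ _ ⟩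
          (ι q * φ v) * (ι p * φ u)             ∎

    onZ₁Powers-isAlgHom : ∀ {γ} → IsDividedPowerSequence γ → IsAlgHom R ι (onZ₁Powers γ)
    onZ₁Powers-isAlgHom {γ} γ-dp = unit , lin-∗ (onZ₁Powers γ) (∑-onZ₁Powers-∗w γ-dp)
      where
      unit : ι ℚ.1ℚ * γ 0 + 0# ≈ 1#
      unit = trans (+-identityʳ _) (trans (*-cong ι.1#-homo (IsDividedPowerSequence.γ-zero γ-dp)) (*-identityˡ 1#))

    ι-fromℕ : ∀ n → ι ((+ n) ℚ./ 1) ≈ n × 1#
    ι-fromℕ zero    = ι.0#-homo
    ι-fromℕ (suc n) = begin
      ι ((+ suc n) ℚ./ 1)           ≡⟨ ≡.cong ι ([1+n]/1≡1+n/1 n) ⟩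
      ι (ℚ.1ℚ ℚ.+ (+ n) ℚ./ 1)      ≈⟨ ι.+-homo ℚ.1ℚ ((+ n) ℚ./ 1) ⟩
      ι ℚ.1ℚ + ι ((+ n) ℚ./ 1)      ≈⟨ +-cong ι.1#-homo (ι-fromℕ n) ⟩
      1# + n × 1#                   ∎

    ι[1/n!]*n!≈1 : ∀ n → ι (1/ n !) * ((n !) × 1#) ≈ 1#
    ι[1/n!]*n!≈1 n = begin
      ι (1/ n !) * ((n !) × 1#)          ≈⟨ *-congˡ (sym (ι-fromℕ (n !))) ⟩
      ι (1/ n !) * ι ((+ (n !)) ℚ./ 1)   ≈⟨ sym (ι.*-homo (1/ n !) ((+ (n !)) ℚ./ 1)) ⟩
      ι (1/ n ! ℚ.* ((+ (n !)) ℚ./ 1))   ≡⟨ ≡.cong ι (1/n*n≡1 (n !) {{n ℕ.!≢0}}) ⟩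
      ι ℚ.1ℚ                             ≈⟨ ι.1#-homo ⟩
      1#                                 ∎

    ι[1/m!]*ι[1/n!] : ∀ m n → ι (1/ m !) * ι (1/ n !) ≈ ((m ℕ.+ n) C m) × ι (1/ (m ℕ.+ n) !)
    ι[1/m!]*ι[1/n!] m n = begin
      e m * e n                               ≈⟨ sym (*-identityʳ _) ⟩
      e m * e n * 1#                          ≈⟨ *-congˡ (sym (ι[1/n!]*n!≈1 N)) ⟩
      e m * e n * (e N * N !̂)                 ≈⟨ *-congˡ (*-congˡ N!≈C*[m!*n!]) ⟩
      e m * e n * (e N * (Ĉ * (m !̂ * n !̂)))
        ≈⟨ solve 6 (λ a b c d f g → (a · b) · (c · (d · (f · g))) ⊜ (c · d) · ((a · f) · (b · g)))
                   ≈-refl (e m) (e n) (e N) Ĉ (m !̂) (n !̂) ⟩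
      e N * Ĉ * (e m * m !̂ * (e n * n !̂))   ≈⟨ *-congˡ (*-cong (ι[1/n!]*n!≈1 m) (ι[1/n!]*n!≈1 n)) ⟩
      e N * Ĉ * (1# * 1#)                     ≈⟨ trans (*-congˡ (*-identityˡ 1#)) (*-identityʳ _) ⟩
      e N * Ĉ                                 ≈⟨ trans (×-comm-* binom (e N) 1#) (×-congʳ binom (*-identityʳ (e N))) ⟩
      binom × e N                             ∎
      where
      open import Algebra.Solver.CommutativeMonoid *-commutativeMonoid using (solve; _⊜_) renaming (_⊕_ to _·_)
      e : ℕ → Carrier
      e k = ι (1/ k !)
      _!̂ : ℕ → Carrier
      k !̂ = (k !) × 1#
      N = m ℕ.+ n
      binom = N C m
      Ĉ = binom × 1#
      N!≈C*[m!*n!] : N !̂ ≈ Ĉ * (m !̂ * n !̂)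
      N!≈C*[m!*n!] = begin
        (N !) × 1#
          ≡⟨ ≡.cong (_× 1#) (≡.sym (nCk*[k!*[n∸k]!]≡n! (ℕ.m≤m+n m n))) ⟩
        (binom ℕ.* (m ! ℕ.* (N ∸ m) !)) × 1#
          ≡⟨ ≡.cong (λ k → (binom ℕ.* (m ! ℕ.* k !)) × 1#) (ℕ.m+n∸m≡n m n) ⟩
        (binom ℕ.* (m ! ℕ.* n !)) × 1#
          ≈⟨ trans (×1-homo-* binom _) (*-congˡ (×1-homo-* (m !) (n !))) ⟩
        Ĉ * (m !̂ * n !̂) ∎

    exp-isDividedPowerSequence : ∀ y → IsDividedPowerSequence (λ n → ι (1/ n !) * y ^ n)
    exp-isDividedPowerSequence y = record
      { γ-zero = trans (*-identityʳ _) ι.1#-homo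
      ; γ-*    = λ m n → begin
          ι (1/ m !) * y ^ m * (ι (1/ n !) * y ^ n)           ≈⟨ interchange _ _ _ _ ⟩
          ι (1/ m !) * ι (1/ n !) * (y ^ m * y ^ n)           ≈⟨ *-cong (ι[1/m!]*ι[1/n!] m n) (sym (^-homo-* y m n)) ⟩
          ((m ℕ.+ n) C m) × ι (1/ (m ℕ.+ n) !) * y ^ (m ℕ.+ n) ≈⟨ ×-assoc-* ((m ℕ.+ n) C m) _ _ ⟩
          ((m ℕ.+ n) C m) × (ι (1/ (m ℕ.+ n) !) * y ^ (m ℕ.+ n)) ∎
      }

    sgn-*-^ : ∀ r y → sgn R ι r * y ^ r ≈ (- y) ^ r
    sgn-*-^ zero    y = *-identityˡ 1#
    sgn-*-^ (suc r) y = begin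
      - sgn R ι r * (y * y ^ r)   ≈⟨ sym (-‿distribˡ-* _ _) ⟩
      - (sgn R ι r * (y * y ^ r)) ≈⟨ -‿cong (x∙yz≈y∙xz _ _ _) ⟩
      - (y * (sgn R ι r * y ^ r)) ≈⟨ -‿distribˡ-* _ _ ⟩
      - y * (sgn R ι r * y ^ r)   ≈⟨ *-congˡ (sgn-*-^ r y) ⟩
      - y * (- y) ^ r             ∎

    ι[1/m!]*ι[1/[n∸m]!] : ∀ {m n} → m ≤ n → ι (1/ m !) * ι (1/ (n ∸ m) !) ≈ (n C m) × ι (1/ n !)
    ι[1/m!]*ι[1/[n∸m]!] {m} {n} m≤n =
      ≡.subst (λ k → ι (1/ m !) * ι (1/ (n ∸ m) !) ≈ (k C m) × ι (1/ k !))
              (ℕ.m+[n∸m]≡n m≤n) (ι[1/m!]*ι[1/n!] m (n ∸ m))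

    ι-μ-replicate-++ : ∀ {c ms} → All (c ≢_) ms → ∀ k → ι (μ (replicate k c ++ ms)) ≈ ι (1/ k !) * ι (μ ms)
    ι-μ-replicate-++ {ms = ms} c∉ms k =
      trans (reflexive (≡.cong ι (μ-replicate-++ c∉ms k))) (ι.*-homo (1/ k !) (μ ms))

    module _ (x : ℕ → Carrier) where

      partialSum : ℕ → Carrier
      partialSum zero    = 0#
      partialSum (suc b) = x (suc b) + partialSum b

      -- The k extra copies of the bound b only change μ; they record the copies of b split off so far.
      prefixedNonIncSum : ℕ → ℕ → ℕ → Carrier
      prefixedNonIncSum k b r = ∑[ ms ∈ nonIncSeqs b r ] (ι (μ (replicate k b ++ ms)) * prod R ι (map x ms))

      nonIncSum : ℕ → ℕ → Carrier
      nonIncSum = prefixedNonIncSum 0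

      prefixedNonIncSum-zero : ∀ k b → prefixedNonIncSum k b 0 ≈ ι (1/ k !)
      prefixedNonIncSum-zero k b = begin
        ι (μ (replicate k b ++ [])) * 1# + 0#  ≈⟨ trans (+-identityʳ _) (*-identityʳ _) ⟩
        ι (μ (replicate k b ++ []))            ≈⟨ ι-μ-replicate-++ [] k ⟩
        ι (1/ k !) * ι ℚ.1ℚ                    ≈⟨ trans (*-congˡ ι.1#-homo) (*-identityʳ _) ⟩
        ι (1/ k !)                             ∎

      nonIncSum-zero : ∀ b → nonIncSum b 0 ≈ 1#
      nonIncSum-zero b = trans (prefixedNonIncSum-zero 0 b) ι.1#-homo

      prefixedNonIncSum-suc : ∀ k b r → prefixedNonIncSum k (suc b) (suc r) ≈
        ι (1/ k !) * nonIncSum b (suc r) + x (suc b) * prefixedNonIncSum (suc k) (suc b) r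
      prefixedNonIncSum-suc k b r = begin
        ∑[ ms ∈ nonIncSeqs (suc b) (suc r) ] term k ms
          ≡⟨ ≡.cong (λ l → ∑[ ms ∈ l ] term k ms) (nonIncSeqs-suc b r) ⟩
        ∑[ ms ∈ nonIncSeqs b (suc r) ++ map (suc b ∷_) (nonIncSeqs (suc b) r) ] term k ms
          ≈⟨ ∑-++ (term k) (nonIncSeqs b (suc r)) _ ⟩
        ∑[ ms ∈ nonIncSeqs b (suc r) ] term k ms + ∑[ ms ∈ map (suc b ∷_) (nonIncSeqs (suc b) r) ] term k ms
          ≈⟨ +-cong lower (reflexive (∑-map (term k) (suc b ∷_) (nonIncSeqs (suc b) r))) ⟩
        ι (1/ k !) * nonIncSum b (suc r) + ∑[ ms ∈ nonIncSeqs (suc b) r ] term k (suc b ∷ ms)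
          ≈⟨ +-congˡ upper ⟩
        ι (1/ k !) * nonIncSum b (suc r) + x (suc b) * prefixedNonIncSum (suc k) (suc b) r ∎
        where
        term : ℕ → List ℕ → Carrier
        term k ms = ι (μ (replicate k (suc b) ++ ms)) * prod R ι (map x ms)

        lower-term : ∀ {ms} → All (_≤ b) ms → term k ms ≈ ι (1/ k !) * term 0 ms
        lower-term ms≤b =
          trans (*-congʳ (ι-μ-replicate-++ (All.map (ℕ.>⇒≢ ∘ ℕ.s≤s) ms≤b) k)) (*-assoc _ _ _)

        lower : ∑[ ms ∈ nonIncSeqs b (suc r) ] term k ms ≈ ι (1/ k !) * nonIncSum b (suc r)
        lower = trans (∑-cong (All.map lower-term (nonIncSeqs-bounded b (suc r))))
                      (sym (*-distribˡ-∑ (ι (1/ k !)) (term 0) (nonIncSeqs b (suc r))))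

        upper-term : ∀ ms → term k (suc b ∷ ms) ≈ x (suc b) * term (suc k) ms
        upper-term ms =
          trans (*-congʳ (reflexive (≡.cong (ι ∘ μ) (replicate-++-∷ k (suc b) ms)))) (x∙yz≈y∙xz _ _ _)

        upper : ∑[ ms ∈ nonIncSeqs (suc b) r ] term k (suc b ∷ ms) ≈ x (suc b) * prefixedNonIncSum (suc k) (suc b) r
        upper = trans (∑-cong {xs = nonIncSeqs (suc b) r} (All.tabulate λ {ms} _ → upper-term ms))
                      (sym (*-distribˡ-∑ (x (suc b)) (term (suc k)) (nonIncSeqs (suc b) r)))

      prefixedNonIncSum-expansion : ∀ k b r → prefixedNonIncSum k (suc b) r ≈
        ∑[ j ≤ r ] (ι (1/ (toℕ j ℕ.+ k) !) * (x (suc b) ^ toℕ j * nonIncSum b (r ∸ toℕ j)))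
      prefixedNonIncSum-expansion k b zero = begin
        prefixedNonIncSum k (suc b) 0             ≈⟨ prefixedNonIncSum-zero k (suc b) ⟩
        ι (1/ k !)                                ≈⟨ sym (*-identityʳ _) ⟩
        ι (1/ k !) * 1#                           ≈⟨ *-congˡ (sym (trans (*-identityˡ _) (nonIncSum-zero b))) ⟩
        ι (1/ k !) * (1# * nonIncSum b 0)         ≈⟨ sym (+-identityʳ _) ⟩
        ι (1/ k !) * (1# * nonIncSum b 0) + 0#    ∎
      prefixedNonIncSum-expansion k b (suc r) = begin
        prefixedNonIncSum k (suc b) (suc r)
          ≈⟨ prefixedNonIncSum-suc k b r ⟩
        ι (1/ k !) * nonIncSum b (suc r) + xₙ * prefixedNonIncSum (suc k) (suc b) r
          ≈⟨ +-cong (*-congˡ (sym (*-identityˡ _))) (*-congˡ (prefixedNonIncSum-expansion (suc k) b r)) ⟩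
        ι (1/ k !) * (1# * nonIncSum b (suc r)) + xₙ * ∑[ j ≤ r ] term (suc k) j
          ≈⟨ +-congˡ (trans (*-distribˡ-sum xₙ (term {r} (suc k))) (sum-cong-≋ shift)) ⟩
        ι (1/ k !) * (1# * nonIncSum b (suc r)) + ∑[ j ≤ r ] term k (Fin.suc j) ∎
        where
        xₙ = x (suc b)
        term : ∀ {n} → ℕ → Fin (suc n) → Carrier
        term {n} l j = ι (1/ (toℕ j ℕ.+ l) !) * (xₙ ^ toℕ j * nonIncSum b (n ∸ toℕ j))
        shift : ∀ (j : Fin (suc r)) → xₙ * term (suc k) j ≈ term k (Fin.suc j)
        shift j = trans (x∙yz≈y∙xz _ _ _)
                        (*-cong (reflexive (≡.cong (λ n → ι (1/ n !)) (ℕ.+-suc (toℕ j) k))) (sym (*-assoc _ _ _)))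

      nonIncSum-multinomial : ∀ b r → nonIncSum b r ≈ ι (1/ r !) * partialSum b ^ r
      nonIncSum-multinomial zero    zero    = trans (nonIncSum-zero 0) (sym (trans (*-identityʳ _) ι.1#-homo))
      nonIncSum-multinomial zero    (suc r) = sym (trans (*-congˡ (zeroˡ _)) (zeroʳ _))
      nonIncSum-multinomial (suc b) r       = begin
        nonIncSum (suc b) r
          ≈⟨ prefixedNonIncSum-expansion 0 b r ⟩
        ∑[ j ≤ r ] (ι (1/ (toℕ j ℕ.+ 0) !) * (xₙ ^ toℕ j * nonIncSum b (r ∸ toℕ j)))
          ≈⟨ sum-cong-≋ term ⟩
        ∑[ j ≤ r ] (ι (1/ r !) * Binomial.binomialTerm xₙ (partialSum b) r j)
          ≈⟨ sym (*-distribˡ-sum (ι (1/ r !)) (Binomial.binomialTerm xₙ (partialSum b) r)) ⟩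
        ι (1/ r !) * Binomial.binomialExpansion xₙ (partialSum b) r
          ≈⟨ *-congˡ (sym (Binomial.theorem r xₙ (partialSum b))) ⟩
        ι (1/ r !) * partialSum (suc b) ^ r ∎
        where
        xₙ = x (suc b)
        term : ∀ (j : Fin (suc r)) → ι (1/ (toℕ j ℕ.+ 0) !) * (xₙ ^ toℕ j * nonIncSum b (r ∸ toℕ j))
                                     ≈ ι (1/ r !) * Binomial.binomialTerm xₙ (partialSum b) r j
        term j = begin
          ι (1/ (i ℕ.+ 0) !) * (xₙ ^ i * nonIncSum b (r ∸ i))
            ≡⟨ ≡.cong (λ n → ι (1/ n !) * (xₙ ^ i * nonIncSum b (r ∸ i))) (ℕ.+-identityʳ i) ⟩
          ι (1/ i !) * (xₙ ^ i * nonIncSum b (r ∸ i))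
            ≈⟨ *-congˡ (*-congˡ (nonIncSum-multinomial b (r ∸ i))) ⟩
          ι (1/ i !) * (xₙ ^ i * (ι (1/ (r ∸ i) !) * partialSum b ^ (r ∸ i)))
            ≈⟨ trans (*-congˡ (x∙yz≈y∙xz _ _ _)) (sym (*-assoc _ _ _)) ⟩
          ι (1/ i !) * ι (1/ (r ∸ i) !) * (xₙ ^ i * partialSum b ^ (r ∸ i))
            ≈⟨ *-congʳ (ι[1/m!]*ι[1/[n∸m]!] (ℕ.s≤s⁻¹ (Fin.toℕ<n j))) ⟩
          (r C i) × ι (1/ r !) * (xₙ ^ i * partialSum b ^ (r ∸ i))
            ≈⟨ trans (×-assoc-* (r C i) _ _) (sym (×-comm-* (r C i) _ _)) ⟩
          ι (1/ r !) * Binomial.binomialTerm xₙ (partialSum b) r j ∎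
          where i = toℕ j

      signedNonIncSum-isDividedPowerSequence : ∀ b → IsDividedPowerSequence (λ r → sgn R ι r * nonIncSum b r)
      signedNonIncSum-isDividedPowerSequence b =
        IsDividedPowerSequence-cong signed (exp-isDividedPowerSequence (- partialSum b))
        where
        signed : ∀ r → sgn R ι r * nonIncSum b r ≈ ι (1/ r !) * (- partialSum b) ^ r
        signed r = begin
          sgn R ι r * nonIncSum b r                     ≈⟨ *-congˡ (nonIncSum-multinomial b r) ⟩
          sgn R ι r * (ι (1/ r !) * partialSum b ^ r)   ≈⟨ x∙yz≈y∙xz _ _ _ ⟩
          ι (1/ r !) * (sgn R ι r * partialSum b ^ r)   ≈⟨ *-congˡ (sgn-*-^ r (partialSum b)) ⟩
          ι (1/ r !) * (- partialSum b) ^ r             ∎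

lemmaA3 : {c ℓ : Level} (R : CommutativeRing c ℓ) (ι : ℚ → CommutativeRing.Carrier R)
          → IsℚAlgebra R ι
          → (f : ℕ → Word → CommutativeRing.Carrier R)
          → (∀ m → 0 < m → IsAlgHom R ι (f m))
          → ∀ M → 0 < M → IsAlgHom R ι (coF R ι f M)
lemmaA3 R ι ι-hom f _ M _ =
  onZ₁Powers-isAlgHom R ι ι-hom
    (signedNonIncSum-isDividedPowerSequence R ι ι-hom (λ m → f m [ 0 ]) (M ∸ 1))
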